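{- Let $n\ge 3$ and let $\mathit{DCD}(n)$ be the combinatorial configuration whose points are the $n$-element subsets and whose lines are the $(n-1)$-element subsets of a $(2n-1)$-element set, a point being incident with a line iff the line's subset is contained in the point's subset. Then $\mathit{DCD}(n)$ is (isomorphic to) an incidence sum $\mathcal C_1\oplus_I\mathcal C_2$ such that: (1) $\mathcal C_1$ is a configuration of type $\left(\binom{2n-2}{n-2}_n,\ \binom{2n-2}{n-1}_{n-1}\right)$; (2) $\mathcal C_2$ is a configuration of type $\left(\binom{2n-2}{n-1}_{n-1},\ \binom{2n-2}{n-2}_n\right)$; (3) the set $I$ of new incidences consists of $\binom{2n-2}{n-1}$ point-line pairs whose points belong to $\mathcal C_2$ and whose lines belong to $\mathcal C_1$; (4) $\mathcal C_1$ and $\mathcal C_2$ are dual to each other; (5) $\mathcal C_1$ and $\mathcal C_2$ are flag-transitive configurations.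
   Context: A configuration of type $(p_q, m_k)$ is an incidence structure with $p$ points and $m$ lines (blocks) such that each line is incident with exactly $k$ points and each point is incident with exactly $q$ lines. The dual of a configuration is obtained by interchanging the roles of points and lines; two configurations are dual to each other if one is isomorphic to the dual of the other. A configuration is flag-transitive if its automorphism group acts transitively on incident point-line pairs (flags). Incidence sum: given configurations $\mathcal C_1,\mathcal C_2$ with point sets $\mathcal P_1,\mathcal P_2$ and line sets $\mathcal L_1,\mathcal L_2$, and a set $I\subseteq (\mathcal P_1\times\mathcal L_2)\cup(\mathcal P_2\times\mathcal L_1)$, the incidence sum $\mathcal C_1\oplus_I\mathcal C_2$ is the incidence structure with point set $\mathcal P_1\sqcup\mathcal P_2$, line set $\mathcal L_1\sqcup\mathcal L_2$, whose incidences are those of $\mathcal C_1$, those of $\mathcal C_2$, and the pairs in $I$. -}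

module Defs where

open import Data.Nat using (ℕ; _*_; _∸_)
open import Data.Fin using (Fin)
open import Data.Bool using (Bool; true; false)
open import Data.Product using (Σ; _×_; _,_; ∃)
open import Data.Sum using (_⊎_; inj₁; inj₂)
open import Data.Fin.Subset using (Subset; ∣_∣)
open import Data.Fin.Subset.Properties using (_⊆?_)
open import Relation.Nullary using (does)
open import Relation.Binary.PropositionalEquality using (_≡_)
open import Function.Bundles using (_↔_; Inverse)

record IncStr : Set₁ where
  constructor mkIncStr
  field
    Point : Set
    Line  : Set
    inc   : Point → Line → Bool
open IncStr public

Flag : IncStr → Set
Flag C = Σ (Point C × Line C) λ { (x , l) → inc C x l ≡ true }

HasCard : Set → ℕ → Set
HasCard A k = A ↔ Fin k

-- Configuration of type (p_q, m_k): p points, m lines, each line incident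
-- with exactly k points, each point incident with exactly q lines.
IsConfig : IncStr → (p q m k : ℕ) → Set
IsConfig C p q m k =
  HasCard (Point C) p × HasCard (Line C) m
  × (∀ l → HasCard (Σ (Point C) λ x → inc C x l ≡ true) k)
  × (∀ x → HasCard (Σ (Line C) λ l → inc C x l ≡ true) q)

record _≅_ (C D : IncStr) : Set where
  field
    pt  : Point C ↔ Point D
    ln  : Line C ↔ Line D
    pres : ∀ x l → inc D (Inverse.to pt x) (Inverse.to ln l) ≡ inc C x l

dual : IncStr → IncStr
dual C = mkIncStr (Line C) (Point C) (λ l x → inc C x l)

DualTo : IncStr → IncStr → Set
DualTo C D = C ≅ dual D

Aut : IncStr → Set
Aut C = C ≅ C

FlagTransitive : IncStr → Set
FlagTransitive C =
  (f g : Flag C) → Σ (Aut C) λ σ →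
    (Inverse.to (_≅_.pt σ) (Data.Product.proj₁ (Data.Product.proj₁ f))
       ≡ Data.Product.proj₁ (Data.Product.proj₁ g))
    × (Inverse.to (_≅_.ln σ) (Data.Product.proj₂ (Data.Product.proj₁ f))
       ≡ Data.Product.proj₂ (Data.Product.proj₁ g))

-- Incidence sum C₁ ⊕_I C₂, with I ⊆ (P₁ × L₂) ∪ (P₂ × L₁) given by its
-- characteristic functions I₁₂ : P₁ → L₂ → Bool and I₂₁ : P₂ → L₁ → Bool.
incSum : (C₁ C₂ : IncStr) → (Point C₁ → Line C₂ → Bool)
       → (Point C₂ → Line C₁ → Bool) → IncStr
incSum C₁ C₂ I₁₂ I₂₁ = mkIncStr (Point C₁ ⊎ Point C₂) (Line C₁ ⊎ Line C₂) i
  where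
  i : Point C₁ ⊎ Point C₂ → Line C₁ ⊎ Line C₂ → Bool
  i (inj₁ x) (inj₁ l) = inc C₁ x l
  i (inj₁ x) (inj₂ l) = I₁₂ x l
  i (inj₂ x) (inj₁ l) = I₂₁ x l
  i (inj₂ x) (inj₂ l) = inc C₂ x l

KSubset : ℕ → ℕ → Set
KSubset N k = Σ (Subset N) λ s → ∣ s ∣ ≡ k

DCD : ℕ → IncStr
DCD n = mkIncStr (KSubset (2 * n ∸ 1) n) (KSubset (2 * n ∸ 1) (n ∸ 1))
  (λ P L → does (Data.Product.proj₁ L ⊆? Data.Product.proj₁ P))

module Submission where

-- Split the ground set of DCD(n) as {0} ⊔ [2n−2]. Points and lines avoiding 0 form C₁
-- (n-sets and (n−1)-sets of [2n−2]); those containing 0 form C₂ ((n−1)-sets and (n−2)-sets,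
-- after deleting 0). A point of C₁ contains no line through 0, and a point S ∪ {0} of C₂
-- contains a line T of C₁ iff T = S, which accounts for the C(2n−2, n−1) new incidences.
-- Complementation in [2n−2] reverses inclusion and carries C₁ onto the dual of C₂. Every
-- permutation of [2n−2] acts on both structures, and two flags L ⊂ P are conjugate because
-- their colourings i ↦ (i ∈ P , i ∈ L) have equal colour-class sizes.

open import Defs
open import Data.Nat using (ℕ; _≤_; _*_; _∸_)
open import Data.Nat.Combinatorics using (_C_)
open import Data.Bool using (Bool; true; false)
open import Data.Product using (Σ; _×_; _,_)
open import Relation.Binary.PropositionalEquality using (_≡_)

open import Axiom.UniquenessOfIdentityProofs using (module Decidable⇒UIP)
open import Data.Bool using (not)
import Data.Bool.Properties as Bool
open import Data.Empty using (⊥-elim)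
open import Data.Fin as Fin using (Fin)
open import Data.Fin.Permutation using (Permutation′; flip; _⟨$⟩ʳ_; _⟨$⟩ˡ_; inverseˡ; inverseʳ; ↔⇒≡)
open import Data.Fin.Properties using (+↔⊎)
open import Data.Fin.Subset using (Subset; ∣_∣; _∈_; _⊆_; ∁)
open import Data.Fin.Subset.Properties
  using (_⊆?_; ⊆-refl; p⊆q⇒∣p∣≤∣q∣; ∣∁p∣≡n∸∣p∣; p⊆q⇒∁p⊇∁q; ∁p⊆∁q⇒p⊇q)
open import Data.Nat using (zero; suc; _+_; s≤s)
open import Data.Nat.Combinatorics using (nCk+nC[k+1]≡[n+1]C[k+1]; nCk≡nC[n∸k])
open import Data.Nat.Properties as ℕ using (+-suc; +-comm; +-identityʳ)
open import Data.Product using (proj₁; proj₂)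
open import Data.Product.Algebra using (Σ-assoc)
open import Data.Product.Properties using (≡-dec; ,-injective)
open import Data.Sum using (_⊎_; inj₁; inj₂; [_,_])
open import Data.Sum.Algebra using (⊎-cong)
open import Data.Vec using (Vec; []; _∷_; lookup; tabulate; count; zip)
open import Data.Vec.Properties
  using (lookup-zip; lookup∘tabulate; tabulate-cong; tabulate∘lookup; []=⇒lookup; lookup⇒[]=; map-∘; map-cong; map-id)
open import Function.Bundles using (_↔_; _⇔_; mk↔ₛ′; mk⇔; Inverse; Equivalence)
open import Function.Properties.Inverse using (↔-refl; ↔-sym; ↔-trans)
open import Relation.Binary.Definitions using (DecidableEquality)
open import Relation.Binary.PropositionalEquality
  using (refl; sym; trans; cong; cong₂; subst; subst₂; module ≡-Reasoning)
open import Relation.Nullary using (¬_; yes; no; does; Irrelevant)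
open import Relation.Nullary.Decidable using (does-⇔; dec-true)

private
  variable
    A B X Y : Set
    a a′ b b′ d k k′ m N : ℕ

-- Counting by bijections with Fin
HasCard-unique : HasCard A m → HasCard A k → m ≡ k
HasCard-unique f g = ↔⇒≡ (↔-trans (↔-sym f) g)

HasCard-↔ : A ↔ B → HasCard B k → HasCard A k
HasCard-↔ = ↔-trans

HasCard-⊎ : HasCard A a → HasCard B b → HasCard (A ⊎ B) (a + b)
HasCard-⊎ f g = ↔-trans (⊎-cong f g) (↔-sym +↔⊎)

HasCard-empty : ¬ A → HasCard A 0
HasCard-empty ¬a = mk↔ₛ′ (λ x → ⊥-elim (¬a x)) (λ ()) (λ ()) (λ x → ⊥-elim (¬a x))

HasCard-singleton : (x : A) → (∀ y → x ≡ y) → HasCard A 1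
HasCard-singleton x unique =
  mk↔ₛ′ (λ _ → Fin.zero) (λ _ → x) (λ { Fin.zero → refl ; (Fin.suc ()) }) unique

Σ-Fin-suc↔ : {P : Fin (suc N) → Set} →
  Σ (Fin (suc N)) P ↔ (P Fin.zero ⊎ Σ (Fin N) (λ i → P (Fin.suc i)))
Σ-Fin-suc↔ = mk↔ₛ′
  (λ { (Fin.zero , p) → inj₁ p ; (Fin.suc i , p) → inj₂ (i , p) })
  [ (Fin.zero ,_) , (λ (i , p) → Fin.suc i , p) ]
  (λ { (inj₁ _) → refl ; (inj₂ _) → refl })
  (λ { (Fin.zero , _) → refl ; (Fin.suc _ , _) → refl })

Σ-Subset-suc↔ : {P : Subset (suc N) → Set} →
  Σ (Subset (suc N)) P ↔ (Σ (Subset N) (λ s → P (false ∷ s)) ⊎ Σ (Subset N) (λ s → P (true ∷ s)))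
Σ-Subset-suc↔ = mk↔ₛ′
  (λ { (false ∷ s , p) → inj₁ (s , p) ; (true ∷ s , p) → inj₂ (s , p) })
  [ (λ (s , p) → false ∷ s , p) , (λ (s , p) → true ∷ s , p) ]
  (λ { (inj₁ _) → refl ; (inj₂ _) → refl })
  (λ { (false ∷ _ , _) → refl ; (true ∷ _ , _) → refl })

Σ-≡-irrelevant : {P : A → Set} → (∀ x → Irrelevant (P x)) →
  {s t : Σ A P} → proj₁ s ≡ proj₁ t → s ≡ t
Σ-≡-irrelevant irr {x , p} {.x , q} refl = cong (x ,_) (irr x p q)

Σ-cong-irrelevant : {P Q : A → Set} → (∀ x → P x ⇔ Q x) →
  (∀ x → Irrelevant (P x)) → (∀ x → Irrelevant (Q x)) → Σ A P ↔ Σ A Q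
Σ-cong-irrelevant P⇔Q irrP irrQ = mk↔ₛ′
  (λ (x , p) → x , Equivalence.to (P⇔Q x) p)
  (λ (x , q) → x , Equivalence.from (P⇔Q x) q)
  (λ _ → Σ-≡-irrelevant irrQ refl)
  (λ _ → Σ-≡-irrelevant irrP refl)

Bool-≡-irrelevant : {x y : Bool} → Irrelevant (x ≡ y)
Bool-≡-irrelevant = Decidable⇒UIP.≡-irrelevant Bool._≟_

≡×≡-irrelevant : {m n : ℕ} {x y : Bool} → Irrelevant ((m ≡ n) × (x ≡ y))
≡×≡-irrelevant (e , h) (e′ , h′) = cong₂ _,_ (ℕ.≡-irrelevant e e′) (Bool-≡-irrelevant h h′)

Σ-≡×-cong : {f g : A → ℕ} {φ : A → Bool} → (∀ t → (f t ≡ m) ⇔ (g t ≡ k)) →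
  Σ A (λ t → f t ≡ m × φ t ≡ true) ↔ Σ A (λ t → g t ≡ k × φ t ≡ true)
Σ-≡×-cong f⇔g = Σ-cong-irrelevant
  (λ t → mk⇔ (λ (e , h) → Equivalence.to (f⇔g t) e , h) (λ (e , h) → Equivalence.from (f⇔g t) e , h))
  (λ _ → ≡×≡-irrelevant) (λ _ → ≡×≡-irrelevant)

suc-≡⇔ : {m n : ℕ} → (suc m ≡ suc n) ⇔ (m ≡ n)
suc-≡⇔ = mk⇔ ℕ.suc-injective (cong suc)

-- Colourings and permutations
fibre : (X → A) → A → Set
fibre {X = X} w c = Σ X λ x → w x ≡ c

domain↔Σ-fibre : (w : X → A) → X ↔ Σ A (fibre w)
domain↔Σ-fibre w = mk↔ₛ′ (λ x → w x , x , refl) (λ (_ , x , _) → x)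
  (λ { (_ , _ , refl) → refl }) (λ _ → refl)

fibres-↔⇒recolouring : (w₁ : X → A) (w₂ : Y → A) → (∀ c → fibre w₁ c ↔ fibre w₂ c) →
  Σ (X ↔ Y) λ σ → ∀ x → w₂ (Inverse.to σ x) ≡ w₁ x
fibres-↔⇒recolouring {X = X} {A = A} {Y = Y} w₁ w₂ F =
  σ , λ x → proj₂ (Inverse.to (F (w₁ x)) (x , refl))
  where
  Σ-fibres : Σ A (fibre w₁) ↔ Σ A (fibre w₂)
  Σ-fibres = mk↔ₛ′ (λ (c , y) → c , Inverse.to (F c) y) (λ (c , y) → c , Inverse.from (F c) y)
    (λ (c , y) → cong (c ,_) (Inverse.strictlyInverseˡ (F c) y))
    (λ (c , y) → cong (c ,_) (Inverse.strictlyInverseʳ (F c) y))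
  σ : X ↔ Y
  σ = ↔-trans (domain↔Σ-fibre w₁) (↔-trans Σ-fibres (↔-sym (domain↔Σ-fibre w₂)))

permute : Permutation′ N → Vec A N → Vec A N
permute σ v = tabulate (λ i → lookup v (σ ⟨$⟩ˡ i))

lookup-permute : (σ : Permutation′ N) (v : Vec A N) (i : Fin N) →
  lookup (permute σ v) i ≡ lookup v (σ ⟨$⟩ˡ i)
lookup-permute σ v = lookup∘tabulate _

permute-pointwise : (σ : Permutation′ N) (u : Vec A N) {v : Vec A N} →
  (∀ i → lookup v (σ ⟨$⟩ʳ i) ≡ lookup u i) → permute σ u ≡ v
permute-pointwise σ u {v} σu≗v = begin
  tabulate (λ j → lookup u (σ ⟨$⟩ˡ j))           ≡⟨ tabulate-cong (λ j → sym (σu≗v (σ ⟨$⟩ˡ j))) ⟩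
  tabulate (λ j → lookup v (σ ⟨$⟩ʳ (σ ⟨$⟩ˡ j)))  ≡⟨ tabulate-cong (λ j → cong (lookup v) (inverseʳ σ)) ⟩
  tabulate (lookup v)                            ≡⟨ tabulate∘lookup v ⟩
  v                                              ∎
  where open ≡-Reasoning

permute-flip : (σ : Permutation′ N) (v : Vec A N) → permute (flip σ) (permute σ v) ≡ v
permute-flip σ v = permute-pointwise (flip σ) (permute σ v) (λ i → sym (lookup-permute σ v i))

permute-flip′ : (σ : Permutation′ N) (v : Vec A N) → permute σ (permute (flip σ) v) ≡ v
permute-flip′ σ v = permute-flip (flip σ) v

module _ (_≟_ : DecidableEquality A) where

  lookup-fibre-card : (v : Vec A N) (c : A) → HasCard (fibre (lookup v) c) (count (_≟ c) v)
  lookup-fibre-card [] c = HasCard-empty λ ()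
  lookup-fibre-card (x ∷ v) c with x ≟ c
  ... | yes x≡c = HasCard-↔ Σ-Fin-suc↔
        (HasCard-⊎ (HasCard-singleton x≡c (Decidable⇒UIP.≡-irrelevant _≟_ x≡c)) (lookup-fibre-card v c))
  ... | no x≢c = HasCard-↔ Σ-Fin-suc↔ (HasCard-⊎ (HasCard-empty x≢c) (lookup-fibre-card v c))

  count-permute : (σ : Permutation′ N) (v : Vec A N) (c : A) →
    count (_≟ c) (permute σ v) ≡ count (_≟ c) v
  count-permute σ v c = HasCard-unique
    (lookup-fibre-card (permute σ v) c) (HasCard-↔ reindex (lookup-fibre-card v c))
    where
    reindex : fibre (lookup (permute σ v)) c ↔ fibre (lookup v) c
    reindex = mk↔ₛ′
      (λ (i , e) → σ ⟨$⟩ˡ i , trans (sym (lookup-permute σ v i)) e)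
      (λ (j , e) → σ ⟨$⟩ʳ j , trans (lookup-permute σ v (σ ⟨$⟩ʳ j)) (trans (cong (lookup v) (inverseˡ σ)) e))
      (λ _ → Σ-≡-irrelevant (λ _ → Decidable⇒UIP.≡-irrelevant _≟_) (inverseˡ σ))
      (λ _ → Σ-≡-irrelevant (λ _ → Decidable⇒UIP.≡-irrelevant _≟_) (inverseʳ σ))

  equal-counts⇒permutation : (u v : Vec A N) → (∀ c → count (_≟ c) u ≡ count (_≟ c) v) →
    Σ (Permutation′ N) λ σ → ∀ i → lookup v (σ ⟨$⟩ʳ i) ≡ lookup u i
  equal-counts⇒permutation u v same = fibres-↔⇒recolouring (lookup u) (lookup v) λ c →
    ↔-trans (subst (HasCard _) (same c) (lookup-fibre-card u c)) (↔-sym (lookup-fibre-card v c))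

-- Subsets
∣permute∣ : (σ : Permutation′ N) (p : Subset N) → ∣ permute σ p ∣ ≡ ∣ p ∣
∣permute∣ σ p = count-permute Bool._≟_ σ p true

∈-permute : (σ : Permutation′ N) (p : Subset N) (x : Fin N) → x ∈ permute σ p ⇔ σ ⟨$⟩ˡ x ∈ p
∈-permute σ p x = mk⇔
  (λ x∈σp → lookup⇒[]= _ p (trans (sym (lookup-permute σ p x)) ([]=⇒lookup x∈σp)))
  (λ σx∈p → lookup⇒[]= x _ (trans (lookup-permute σ p x) ([]=⇒lookup σx∈p)))

⊆-permute : (σ : Permutation′ N) {p q : Subset N} → p ⊆ q → permute σ p ⊆ permute σ q
⊆-permute σ {p} {q} p⊆q {x} x∈σp =
  Equivalence.from (∈-permute σ q x) (p⊆q (Equivalence.to (∈-permute σ p x) x∈σp))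

⊆?-permute : (σ : Permutation′ N) (p q : Subset N) → does (permute σ p ⊆? permute σ q) ≡ does (p ⊆? q)
⊆?-permute σ p q = does-⇔ (mk⇔ reflect (⊆-permute σ)) (permute σ p ⊆? permute σ q) (p ⊆? q)
  where
  reflect : permute σ p ⊆ permute σ q → p ⊆ q
  reflect h = subst₂ _⊆_ (permute-flip σ p) (permute-flip σ q) (⊆-permute (flip σ) h)

∁-involutive : (p : Subset N) → ∁ (∁ p) ≡ p
∁-involutive p = trans (sym (map-∘ not not p)) (trans (map-cong Bool.not-involutive p) (map-id p))

⊆?-∁ : (p q : Subset N) → does (∁ p ⊆? ∁ q) ≡ does (q ⊆? p)
⊆?-∁ p q = does-⇔ (mk⇔ (∁p⊆∁q⇒p⊇q {p = p}) (p⊆q⇒∁p⊇∁q {p = q})) (∁ p ⊆? ∁ q) (q ⊆? p)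

⊆?-refl : (p : Subset N) → does (p ⊆? p) ≡ true
⊆?-refl p = dec-true (p ⊆? p) ⊆-refl

⊆?-sound : {p q : Subset N} → does (p ⊆? q) ≡ true → p ⊆ q
⊆?-sound {p = p} {q} h with p ⊆? q | h
... | yes p⊆q | _ = p⊆q
... | no _ | ()

⊆?∧∣≡∣⇒≡ : (p q : Subset N) → does (p ⊆? q) ≡ true → ∣ p ∣ ≡ ∣ q ∣ → p ≡ q
⊆?∧∣≡∣⇒≡ [] [] _ _ = refl
⊆?∧∣≡∣⇒≡ (false ∷ p) (false ∷ q) p⊆q eq = cong (false ∷_) (⊆?∧∣≡∣⇒≡ p q p⊆q eq)
⊆?∧∣≡∣⇒≡ (false ∷ p) (true ∷ q) p⊆q eq =
  ⊥-elim (ℕ.n≮n ∣ q ∣ (subst (_≤ ∣ q ∣) eq (p⊆q⇒∣p∣≤∣q∣ (⊆?-sound {p = p} p⊆q))))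
⊆?∧∣≡∣⇒≡ (true ∷ p) (true ∷ q) p⊆q eq = cong (true ∷_) (⊆?∧∣≡∣⇒≡ p q p⊆q (ℕ.suc-injective eq))

facet-card : (s : Subset N) →
  HasCard (Σ (Subset N) λ t → suc ∣ t ∣ ≡ ∣ s ∣ × does (t ⊆? s) ≡ true) ∣ s ∣
facet-card [] = HasCard-empty λ { (_ , () , _) }
facet-card (false ∷ s) = HasCard-↔ Σ-Subset-suc↔
  (subst (HasCard _) (+-identityʳ ∣ s ∣) (HasCard-⊎ (facet-card s) (HasCard-empty λ { (_ , _ , ()) })))
facet-card (true ∷ s) = HasCard-↔ Σ-Subset-suc↔
  (HasCard-⊎ (HasCard-singleton (s , refl , ⊆?-refl s) only-s)
             (HasCard-↔ (Σ-≡×-cong λ _ → suc-≡⇔) (facet-card s)))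
  where
  only-s : ∀ t → (s , refl , ⊆?-refl s) ≡ t
  only-s (t , eq , t⊆s) = Σ-≡-irrelevant (λ _ → ≡×≡-irrelevant)
    (sym (⊆?∧∣≡∣⇒≡ t s t⊆s (ℕ.suc-injective eq)))

cofacet-card : (s : Subset N) →
  HasCard (Σ (Subset N) λ t → ∣ t ∣ ≡ suc ∣ s ∣ × does (s ⊆? t) ≡ true) ∣ ∁ s ∣
cofacet-card [] = HasCard-empty λ { ([] , () , _) }
cofacet-card (false ∷ s) = HasCard-↔ Σ-Subset-suc↔
  (subst (HasCard _) (+-comm ∣ ∁ s ∣ 1)
    (HasCard-⊎ (cofacet-card s) (HasCard-singleton (s , refl , ⊆?-refl s) only-s)))
  where
  only-s : ∀ t → (s , refl , ⊆?-refl s) ≡ t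
  only-s (t , eq , s⊆t) = Σ-≡-irrelevant (λ _ → ≡×≡-irrelevant)
    (⊆?∧∣≡∣⇒≡ s t s⊆t (sym (ℕ.suc-injective eq)))
cofacet-card (true ∷ s) = HasCard-↔ Σ-Subset-suc↔
  (HasCard-⊎ (HasCard-empty λ { (_ , _ , ()) }) (HasCard-↔ (Σ-≡×-cong λ _ → suc-≡⇔) (cofacet-card s)))

-- Subsets of a fixed size
KSubset-≡ : {s t : KSubset N k} → proj₁ s ≡ proj₁ t → s ≡ t
KSubset-≡ = Σ-≡-irrelevant (λ _ → ℕ.≡-irrelevant)

KSubset-suc↔ : KSubset (suc N) (suc k) ↔ (KSubset N (suc k) ⊎ KSubset N k)
KSubset-suc↔ = ↔-trans Σ-Subset-suc↔
  (⊎-cong ↔-refl (Σ-cong-irrelevant (λ _ → suc-≡⇔) (λ _ → ℕ.≡-irrelevant) (λ _ → ℕ.≡-irrelevant)))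

card-KSubset : ∀ N k → HasCard (KSubset N k) (N C k)
card-KSubset zero zero = HasCard-singleton ([] , refl) λ { ([] , refl) → refl }
card-KSubset zero (suc k) = HasCard-empty λ { ([] , ()) }
card-KSubset (suc N) zero =
  HasCard-↔ Σ-Subset-suc↔ (HasCard-⊎ (card-KSubset N zero) (HasCard-empty λ { (_ , ()) }))
card-KSubset (suc N) (suc k) = subst (HasCard _) pascal
  (HasCard-↔ KSubset-suc↔ (HasCard-⊎ (card-KSubset N (suc k)) (card-KSubset N k)))
  where
  pascal : N C suc k + N C k ≡ suc N C suc k
  pascal = trans (+-comm (N C suc k) (N C k)) (nCk+nC[k+1]≡[n+1]C[k+1] N k)

C-complement : a + b ≡ N → N C a ≡ N C b
C-complement {a} {b} {N} a+b≡N = begin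
  N C a            ≡⟨ nCk≡nC[n∸k] (subst (a ≤_) a+b≡N (ℕ.m≤m+n a b)) ⟩
  N C (N ∸ a)      ≡⟨ cong (λ x → N C (x ∸ a)) (sym a+b≡N) ⟩
  N C (a + b ∸ a)  ≡⟨ cong (N C_) (ℕ.m+n∸m≡n a b) ⟩
  N C b            ∎
  where open ≡-Reasoning

∣∁∣ : k + k′ ≡ N → (p : Subset N) → ∣ p ∣ ≡ k → ∣ ∁ p ∣ ≡ k′
∣∁∣ {k} {k′} {N} k+k′≡N p ∣p∣≡k = begin
  ∣ ∁ p ∣      ≡⟨ ∣∁p∣≡n∸∣p∣ p ⟩
  N ∸ ∣ p ∣    ≡⟨ cong₂ _∸_ (sym k+k′≡N) ∣p∣≡k ⟩
  k + k′ ∸ k   ≡⟨ ℕ.m+n∸m≡n k k′ ⟩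
  k′           ∎
  where open ≡-Reasoning

∁-KSubset↔ : k + k′ ≡ N → KSubset N k ↔ KSubset N k′
∁-KSubset↔ {k} {k′} k+k′≡N = mk↔ₛ′
  (λ (p , ∣p∣≡k) → ∁ p , ∣∁∣ k+k′≡N p ∣p∣≡k)
  (λ (p , ∣p∣≡k′) → ∁ p , ∣∁∣ (trans (+-comm k′ k) k+k′≡N) p ∣p∣≡k′)
  (λ (p , _) → KSubset-≡ (∁-involutive p))
  (λ (p , _) → KSubset-≡ (∁-involutive p))

permute-KSubset↔ : Permutation′ N → KSubset N k ↔ KSubset N k
permute-KSubset↔ σ = mk↔ₛ′
  (λ (p , ∣p∣≡k) → permute σ p , trans (∣permute∣ σ p) ∣p∣≡k)
  (λ (p , ∣p∣≡k) → permute (flip σ) p , trans (∣permute∣ (flip σ) p) ∣p∣≡k)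
  (λ (p , _) → KSubset-≡ (permute-flip′ σ p))
  (λ (p , _) → KSubset-≡ (permute-flip σ p))

-- Inclusion structures
Inclusion : (N a b : ℕ) → IncStr
Inclusion N a b = mkIncStr (KSubset N a) (KSubset N b) (λ P L → does (proj₁ L ⊆? proj₁ P))

Inclusion-isConfig : b + d ≡ N → IsConfig (Inclusion N (suc b) b) (N C suc b) (suc b) (N C b) d
Inclusion-isConfig {b} {d} {N} b+d≡N =
  card-KSubset N (suc b) , card-KSubset N b , line-degree , point-degree
  where
  line-degree : (L : KSubset N b) →
    HasCard (Σ (KSubset N (suc b)) λ P → does (proj₁ L ⊆? proj₁ P) ≡ true) d
  line-degree (l , ∣l∣≡b) = HasCard-↔
    (↔-trans Σ-assoc (Σ-≡×-cong λ _ →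
      mk⇔ (λ e → trans e (cong suc (sym ∣l∣≡b))) (λ e → trans e (cong suc ∣l∣≡b))))
    (subst (HasCard _) (∣∁∣ b+d≡N l ∣l∣≡b) (cofacet-card l))
  point-degree : (P : KSubset N (suc b)) →
    HasCard (Σ (KSubset N b) λ L → does (proj₁ L ⊆? proj₁ P) ≡ true) (suc b)
  point-degree (s , ∣s∣≡1+b) = HasCard-↔
    (↔-trans Σ-assoc (Σ-≡×-cong λ _ →
      mk⇔ (λ e → trans (cong suc e) (sym ∣s∣≡1+b)) (λ e → ℕ.suc-injective (trans e ∣s∣≡1+b))))
    (subst (HasCard _) ∣s∣≡1+b (facet-card s))

Inclusion-∁-dual : a + a′ ≡ N → b + b′ ≡ N → Inclusion N a b ≅ dual (Inclusion N b′ a′)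
Inclusion-∁-dual a+a′≡N b+b′≡N = record
  { pt = ∁-KSubset↔ a+a′≡N
  ; ln = ∁-KSubset↔ b+b′≡N
  ; pres = λ (P , _) (L , _) → ⊆?-∁ P L
  }

Inclusion-aut : Permutation′ N → Aut (Inclusion N a b)
Inclusion-aut σ = record
  { pt = permute-KSubset↔ σ
  ; ln = permute-KSubset↔ σ
  ; pres = λ (P , _) (L , _) → ⊆?-permute σ L P
  }

Inclusion-split : Inclusion (suc N) (suc (suc b)) (suc b) ≅
  incSum (Inclusion N (suc (suc b)) (suc b)) (Inclusion N (suc b) b)
         (λ _ _ → false) (inc (Inclusion N (suc b) (suc b)))
Inclusion-split {N} {b} = record { pt = KSubset-suc↔ ; ln = KSubset-suc↔ ; pres = pres }
  where
  C₁⊕C₂ : IncStr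
  C₁⊕C₂ = incSum (Inclusion N (suc (suc b)) (suc b)) (Inclusion N (suc b) b)
                 (λ _ _ → false) (inc (Inclusion N (suc b) (suc b)))
  pres : ∀ P L → inc C₁⊕C₂ (Inverse.to KSubset-suc↔ P) (Inverse.to KSubset-suc↔ L)
               ≡ inc (Inclusion (suc N) (suc (suc b)) (suc b)) P L
  pres (false ∷ _ , _) (false ∷ _ , _) = refl
  pres (false ∷ _ , _) (true ∷ _ , _) = refl
  pres (true ∷ _ , _) (false ∷ _ , _) = refl
  pres (true ∷ _ , _) (true ∷ _ , _) = refl

Inclusion-diagonal-card : HasCard (Flag (Inclusion N k k)) (N C k)
Inclusion-diagonal-card {N} {k} = HasCard-↔ flag↔point (card-KSubset N k)
  where
  flag↔point : Flag (Inclusion N k k) ↔ KSubset N k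
  flag↔point = mk↔ₛ′ (λ ((P , _) , _) → P) (λ P → (P , P) , ⊆?-refl (proj₁ P)) (λ _ → refl)
    (λ (((p , ∣p∣≡k) , (l , ∣l∣≡k)) , l⊆p) → Σ-≡-irrelevant (λ _ → Bool-≡-irrelevant)
      (cong ((p , ∣p∣≡k) ,_) (KSubset-≡ (sym (⊆?∧∣≡∣⇒≡ l p l⊆p (trans ∣l∣≡k (sym ∣p∣≡k)))))))

-- Flags
_≟²_ : DecidableEquality (Bool × Bool)
_≟²_ = ≡-dec Bool._≟_ Bool._≟_

#[_] : Bool × Bool → Vec (Bool × Bool) N → ℕ
#[ c ] = count (_≟² c)

count-zip-ft : (P L : Subset N) → does (L ⊆? P) ≡ true → #[ false , true ] (zip P L) ≡ 0
count-zip-ft [] [] _ = refl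
count-zip-ft (true ∷ P) (true ∷ L) L⊆P = count-zip-ft P L L⊆P
count-zip-ft (true ∷ P) (false ∷ L) L⊆P = count-zip-ft P L L⊆P
count-zip-ft (false ∷ P) (false ∷ L) L⊆P = count-zip-ft P L L⊆P

count-zip-tt : (P L : Subset N) → does (L ⊆? P) ≡ true → #[ true , true ] (zip P L) ≡ ∣ L ∣
count-zip-tt [] [] _ = refl
count-zip-tt (true ∷ P) (true ∷ L) L⊆P = cong suc (count-zip-tt P L L⊆P)
count-zip-tt (true ∷ P) (false ∷ L) L⊆P = count-zip-tt P L L⊆P
count-zip-tt (false ∷ P) (false ∷ L) L⊆P = count-zip-tt P L L⊆P

count-zip-tf : (P L : Subset N) → does (L ⊆? P) ≡ true → #[ true , false ] (zip P L) + ∣ L ∣ ≡ ∣ P ∣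
count-zip-tf [] [] _ = refl
count-zip-tf (true ∷ P) (true ∷ L) L⊆P = trans (+-suc _ ∣ L ∣) (cong suc (count-zip-tf P L L⊆P))
count-zip-tf (true ∷ P) (false ∷ L) L⊆P = cong suc (count-zip-tf P L L⊆P)
count-zip-tf (false ∷ P) (false ∷ L) L⊆P = count-zip-tf P L L⊆P

count-zip-ff : (P L : Subset N) → does (L ⊆? P) ≡ true → #[ false , false ] (zip P L) + ∣ P ∣ ≡ N
count-zip-ff [] [] _ = refl
count-zip-ff (true ∷ P) (true ∷ L) L⊆P = trans (+-suc _ ∣ P ∣) (cong suc (count-zip-ff P L L⊆P))
count-zip-ff (true ∷ P) (false ∷ L) L⊆P = trans (+-suc _ ∣ P ∣) (cong suc (count-zip-ff P L L⊆P))
count-zip-ff (false ∷ P) (false ∷ L) L⊆P = cong suc (count-zip-ff P L L⊆P)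

flag-profile : ℕ → ℕ → Bool × Bool → ℕ
flag-profile N b (true , true) = b
flag-profile N b (true , false) = 1
flag-profile N b (false , true) = 0
flag-profile N b (false , false) = N ∸ suc b

count-zip-flag : (P L : Subset N) → does (L ⊆? P) ≡ true → ∣ P ∣ ≡ suc b → ∣ L ∣ ≡ b →
  ∀ c → #[ c ] (zip P L) ≡ flag-profile N b c
count-zip-flag P L L⊆P ∣P∣≡1+b ∣L∣≡b (true , true) = trans (count-zip-tt P L L⊆P) ∣L∣≡b
count-zip-flag {b = b} P L L⊆P ∣P∣≡1+b ∣L∣≡b (true , false) = ℕ.+-cancelʳ-≡ b _ 1
  (trans (cong (#[ true , false ] (zip P L) +_) (sym ∣L∣≡b)) (trans (count-zip-tf P L L⊆P) ∣P∣≡1+b))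
count-zip-flag P L L⊆P ∣P∣≡1+b ∣L∣≡b (false , true) = count-zip-ft P L L⊆P
count-zip-flag {b = b} P L L⊆P ∣P∣≡1+b ∣L∣≡b (false , false) =
  trans (sym (ℕ.m+n∸n≡m (#[ false , false ] (zip P L)) (suc b)))
    (cong (_∸ suc b) (trans (cong (#[ false , false ] (zip P L) +_) (sym ∣P∣≡1+b)) (count-zip-ff P L L⊆P)))

flags-conjugate : (P₁ L₁ P₂ L₂ : Subset N) →
  does (L₁ ⊆? P₁) ≡ true → ∣ P₁ ∣ ≡ suc b → ∣ L₁ ∣ ≡ b →
  does (L₂ ⊆? P₂) ≡ true → ∣ P₂ ∣ ≡ suc b → ∣ L₂ ∣ ≡ b →
  Σ (Permutation′ N) λ σ → permute σ P₁ ≡ P₂ × permute σ L₁ ≡ L₂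
flags-conjugate P₁ L₁ P₂ L₂ L₁⊆P₁ ∣P₁∣ ∣L₁∣ L₂⊆P₂ ∣P₂∣ ∣L₂∣
  with equal-counts⇒permutation _≟²_ (zip P₁ L₁) (zip P₂ L₂) (λ c →
         trans (count-zip-flag P₁ L₁ L₁⊆P₁ ∣P₁∣ ∣L₁∣ c) (sym (count-zip-flag P₂ L₂ L₂⊆P₂ ∣P₂∣ ∣L₂∣ c)))
... | σ , σ-matches =
  σ , permute-pointwise σ P₁ (λ i → proj₁ (unzip-match i))
    , permute-pointwise σ L₁ (λ i → proj₂ (unzip-match i))
  where
  unzip-match : ∀ i → lookup P₂ (σ ⟨$⟩ʳ i) ≡ lookup P₁ i × lookup L₂ (σ ⟨$⟩ʳ i) ≡ lookup L₁ i
  unzip-match i = ,-injective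
    (trans (sym (lookup-zip (σ ⟨$⟩ʳ i) P₂ L₂)) (trans (σ-matches i) (lookup-zip i P₁ L₁)))

Inclusion-flagTransitive : FlagTransitive (Inclusion N (suc b) b)
Inclusion-flagTransitive (((P₁ , ∣P₁∣) , (L₁ , ∣L₁∣)) , L₁⊆P₁) (((P₂ , ∣P₂∣) , (L₂ , ∣L₂∣)) , L₂⊆P₂)
  with flags-conjugate P₁ L₁ P₂ L₂ L₁⊆P₁ ∣P₁∣ ∣L₁∣ L₂⊆P₂ ∣P₂∣ ∣L₂∣
... | σ , σP₁≡P₂ , σL₁≡L₂ = Inclusion-aut σ , KSubset-≡ σP₁≡P₂ , KSubset-≡ σL₁≡L₂

-- The construction only needs n ≥ 2.
theorem4p2 : (n : ℕ) → 3 ≤ n →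
    Σ IncStr λ C₁ → Σ IncStr λ C₂ →
    Σ (Point C₁ → Line C₂ → Bool) λ I₁₂ →
    Σ (Point C₂ → Line C₁ → Bool) λ I₂₁ →
      (DCD n ≅ incSum C₁ C₂ I₁₂ I₂₁)
      × IsConfig C₁ ((2 * n ∸ 2) C (n ∸ 2)) n ((2 * n ∸ 2) C (n ∸ 1)) (n ∸ 1)
      × IsConfig C₂ ((2 * n ∸ 2) C (n ∸ 1)) (n ∸ 1) ((2 * n ∸ 2) C (n ∸ 2)) n
      × (∀ x l → I₁₂ x l ≡ false)
      × HasCard (Σ (Point C₂ × Line C₁) λ { (x , l) → I₂₁ x l ≡ true })
          ((2 * n ∸ 2) C (n ∸ 1))
      × DualTo C₁ C₂
      × FlagTransitive C₁
      × FlagTransitive C₂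
theorem4p2 1 (s≤s ())
theorem4p2 n@(suc (suc m)) _ =
  Inclusion (2 * n ∸ 2) n (suc m) ,
  Inclusion (2 * n ∸ 2) (suc m) m ,
  (λ _ _ → false) , inc (Inclusion (2 * n ∸ 2) (suc m) (suc m)) ,
  Inclusion-split ,
  subst (λ p → IsConfig (Inclusion (2 * n ∸ 2) n (suc m)) p n ((2 * n ∸ 2) C suc m) (suc m))
        (C-complement {a = n} {b = m} n+m≡2n-2) (Inclusion-isConfig 1+m+1+m≡2n-2) ,
  Inclusion-isConfig m+n≡2n-2 ,
  (λ _ _ → refl) ,
  Inclusion-diagonal-card ,
  Inclusion-∁-dual n+m≡2n-2 1+m+1+m≡2n-2 ,
  Inclusion-flagTransitive ,
  Inclusion-flagTransitive
  where
  m+n≡2n-2 : m + n ≡ 2 * n ∸ 2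
  m+n≡2n-2 = cong (λ x → m + suc (suc x)) (sym (+-identityʳ m))
  n+m≡2n-2 : n + m ≡ 2 * n ∸ 2
  n+m≡2n-2 = trans (+-comm n m) m+n≡2n-2
  1+m+1+m≡2n-2 : suc m + suc m ≡ 2 * n ∸ 2
  1+m+1+m≡2n-2 = trans (+-suc (suc m) m) n+m≡2n-2
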